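{- Let $\mathbb T$ be the theory of bounded distributive lattices. If an $\mathbb I$-algebra $A$ satisfies the generalised Phoa principle, then so does the polynomial $\mathbb I$-algebra $A[\mathsf j]$.
   Context: We work in intensional type theory with function extensionality. $\mathbb I$ is a bounded distributive lattice; an $\mathbb I$-algebra is a bounded distributive lattice $A$ with a homomorphism $\mathbb I\to A$ (elements of $\mathbb I$ identified with their images). $A[\mathsf j]$ is the free $\mathbb I$-algebra over $A$ on one generator $\mathsf j$ (the polynomial algebra). An $\mathbb I$-algebra $A$ satisfies the generalised Phoa principle if for every function $\alpha:\mathbb I\to A$ and every $i:\mathbb I$, $\alpha(i)=\alpha(0)\vee(i\wedge\alpha(1))$; equivalently, the map $A^{\mathbb I}\to A\times A$, $\alpha\mapsto(\alpha(0),\alpha(1))$, is an embedding with image $\{(a,b)\mid a\le_A b\}$. -}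

module Defs where

open import Level using (Level; suc; _⊔_)
open import Relation.Binary.PropositionalEquality using (_≡_)
open import Algebra.Core using (Op₂)
import Algebra.Definitions as Defn
import Algebra.Lattice.Structures as LS
open import Data.Product using (Σ; _×_; _,_)

-- Bounded distributive lattices, with equality the identity type _≡_
-- (the paper works in intensional type theory: equality is identity).
record BDL (ℓ : Level) : Set (suc ℓ) where
  infixr 6 _∨_
  infixr 7 _∧_
  field
    Carrier : Set ℓ
    _∨_ _∧_ : Op₂ Carrier
    ⊥ ⊤ : Carrier
    isDistributiveLattice : LS.IsDistributiveLattice {A = Carrier} _≡_ _∨_ _∧_
    ∨-identity : Defn.Identity {A = Carrier} _≡_ ⊥ _∨_
    ∧-identity : Defn.Identity {A = Carrier} _≡_ ⊤ _∧_

record IsBDLHom {a b : Level} (A : BDL a) (B : BDL b)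
                (f : BDL.Carrier A → BDL.Carrier B) : Set (a ⊔ b) where
  private
    module A = BDL A
    module B = BDL B
  field
    pres-∨ : ∀ x y → f (x A.∨ y) ≡ f x B.∨ f y
    pres-∧ : ∀ x y → f (x A.∧ y) ≡ f x B.∧ f y
    pres-⊥ : f A.⊥ ≡ B.⊥
    pres-⊤ : f A.⊤ ≡ B.⊤

record IAlg {i : Level} (𝕀 : BDL i) (ℓ : Level) : Set (i ⊔ suc ℓ) where
  field
    lattice : BDL ℓ
    ι : BDL.Carrier 𝕀 → BDL.Carrier lattice
    ι-hom : IsBDLHom 𝕀 lattice ι
  open BDL lattice public

record IsIAlgHom {i a b : Level} {𝕀 : BDL i} (A : IAlg 𝕀 a) (B : IAlg 𝕀 b)
                 (f : IAlg.Carrier A → IAlg.Carrier B) : Set (i ⊔ a ⊔ b) where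
  field
    isBDLHom : IsBDLHom (IAlg.lattice A) (IAlg.lattice B) f
    pres-ι : ∀ x → f (IAlg.ι A x) ≡ IAlg.ι B x

GenPhoa : {i a : Level} {𝕀 : BDL i} → IAlg 𝕀 a → Set (i ⊔ a)
GenPhoa {𝕀 = 𝕀} A =
  (α : BDL.Carrier 𝕀 → IAlg.Carrier A) (x : BDL.Carrier 𝕀) →
  α x ≡ α (BDL.⊥ 𝕀) A.∨ (A.ι x A.∧ α (BDL.⊤ 𝕀))
  where module A = IAlg A

-- (B, η, j) is a polynomial 𝕀-algebra A[j]: the free 𝕀-algebra over A on one
-- generator j.
record IsPolynomialAlgebra {i ℓ : Level} {𝕀 : BDL i} (A B : IAlg 𝕀 ℓ)
       (η : IAlg.Carrier A → IAlg.Carrier B) (j : IAlg.Carrier B)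
       : Set (i ⊔ suc ℓ) where
  field
    η-hom : IsIAlgHom A B η
    extend : (C : IAlg 𝕀 ℓ) (f : IAlg.Carrier A → IAlg.Carrier C) →
             IsIAlgHom A C f → (c : IAlg.Carrier C) →
             IAlg.Carrier B → IAlg.Carrier C
    extend-hom : (C : IAlg 𝕀 ℓ) (f : IAlg.Carrier A → IAlg.Carrier C)
                 (fh : IsIAlgHom A C f) (c : IAlg.Carrier C) →
                 IsIAlgHom B C (extend C f fh c)
    extend-η : (C : IAlg 𝕀 ℓ) (f : IAlg.Carrier A → IAlg.Carrier C)
               (fh : IsIAlgHom A C f) (c : IAlg.Carrier C) →
               ∀ x → extend C f fh c (η x) ≡ f x
    extend-j : (C : IAlg 𝕀 ℓ) (f : IAlg.Carrier A → IAlg.Carrier C)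
               (fh : IsIAlgHom A C f) (c : IAlg.Carrier C) →
               extend C f fh c j ≡ c
    extend-unique : (C : IAlg 𝕀 ℓ) (f : IAlg.Carrier A → IAlg.Carrier C)
                    (fh : IsIAlgHom A C f) (c : IAlg.Carrier C)
                    (g : IAlg.Carrier B → IAlg.Carrier C) →
                    IsIAlgHom B C g → (∀ x → g (η x) ≡ f x) → g j ≡ c →
                    ∀ y → g y ≡ extend C f fh c y

{-# OPTIONS --safe #-}

-- Evaluating at 0 and at 1 gives 𝕀-algebra maps e₀, e₁ : A[j] → A, and the
-- Phoa principle in A makes e₀ ≤ e₁ pointwise. In a distributive lattice
-- y ↦ η (e₀ y) ∨ (j ∧ η (e₁ y)) is then an 𝕀-algebra endomorphism of A[j]
-- fixing A and j, hence the identity: every element of A[j] is determined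
-- by its two evaluations. For α : 𝕀 → A[j], the elements α x and
-- α 0 ∨ (x ∧ α 1) have the same evaluations by the Phoa principle in A.

module Submission where

open import Defs
open import Level using (Level)
open import Function using (id; _∘_)
open import Relation.Binary.PropositionalEquality
open import Data.Product using (proj₁; proj₂)
open import Algebra.Bundles using (CommutativeSemigroup)
open import Algebra.Lattice.Bundles using (Lattice)
open import Algebra.Lattice.Structures using (module IsDistributiveLattice)
import Algebra.Lattice.Properties.Lattice as LatticeProperties
import Algebra.Properties.CommutativeSemigroup as CommutativeSemigroupProperties

module BDLProperties {ℓ : Level} (L : BDL ℓ) where
  open BDL L
  open IsDistributiveLattice isDistributiveLattice
    using ( isLattice; ∨-comm; ∧-comm; ∨-absorbs-∧; ∧-absorbs-∨
          ; ∨-distribˡ-∧; ∨-distribʳ-∧; ∧-distribˡ-∨)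
  open ≡-Reasoning

  lattice : Lattice ℓ ℓ
  lattice = record { isLattice = isLattice }

  open LatticeProperties lattice using (∧-isSemigroup; ∨-isSemigroup)

  ∧-commutativeSemigroup : CommutativeSemigroup ℓ ℓ
  ∧-commutativeSemigroup = record
    { isCommutativeSemigroup = record { isSemigroup = ∧-isSemigroup ; comm = ∧-comm } }

  ∨-commutativeSemigroup : CommutativeSemigroup ℓ ℓ
  ∨-commutativeSemigroup = record
    { isCommutativeSemigroup = record { isSemigroup = ∨-isSemigroup ; comm = ∨-comm } }

  open CommutativeSemigroupProperties ∧-commutativeSemigroup
    using () renaming (interchange to ∧-interchange)
  open CommutativeSemigroupProperties ∨-commutativeSemigroup
    using () renaming (interchange to ∨-interchange)

  infix 4 _≤_
  _≤_ : Carrier → Carrier → Set ℓ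
  x ≤ y = x ∨ y ≡ y

  ≤⇒∧≡ : ∀ {x y} → x ≤ y → x ∧ y ≡ x
  ≤⇒∧≡ {x} {y} x∨y≡y = trans (cong (x ∧_) (sym x∨y≡y)) (∧-absorbs-∨ x y)

  ∧≡⇒≤ : ∀ {x y} → x ∧ y ≡ x → x ≤ y
  ∧≡⇒≤ {x} {y} x∧y≡x = begin
    x ∨ y        ≡⟨ cong (_∨ y) (sym x∧y≡x) ⟩
    x ∧ y ∨ y    ≡⟨ ∨-comm (x ∧ y) y ⟩
    y ∨ x ∧ y    ≡⟨ cong (y ∨_) (∧-comm x y) ⟩
    y ∨ y ∧ x    ≡⟨ ∨-absorbs-∧ y x ⟩
    y            ∎

  ∧-mono-≤ : ∀ {x y u v} → x ≤ y → u ≤ v → x ∧ u ≤ y ∧ v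
  ∧-mono-≤ {x} {y} {u} {v} x≤y u≤v = ∧≡⇒≤ (begin
    (x ∧ u) ∧ (y ∧ v)  ≡⟨ ∧-interchange x u y v ⟩
    (x ∧ y) ∧ (u ∧ v)  ≡⟨ cong₂ _∧_ (≤⇒∧≡ x≤y) (≤⇒∧≡ u≤v) ⟩
    x ∧ u              ∎)

  ∨-zeroˡ : ∀ x → ⊤ ∨ x ≡ ⊤
  ∨-zeroˡ x = trans (cong (⊤ ∨_) (sym (proj₁ ∧-identity x))) (∨-absorbs-∧ ⊤ x)

  modular : ∀ j {x y} → x ≤ y → x ∨ j ∧ y ≡ (x ∨ j) ∧ y
  modular j {x} {y} x≤y = trans (∨-distribˡ-∧ x j y) (cong ((x ∨ j) ∧_) x≤y)

  -- GenPhoa A says α i ≡ interpolate (ι i) (α ⊥) (α ⊤) for every α : 𝕀 → A.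
  interpolate : Carrier → Carrier → Carrier → Carrier
  interpolate j x y = x ∨ j ∧ y

  interpolate-diagonal : ∀ j x → interpolate j x x ≡ x
  interpolate-diagonal j x = trans (cong (x ∨_) (∧-comm j x)) (∨-absorbs-∧ x j)

  interpolate-⊤ : ∀ j y → interpolate j ⊤ y ≡ ⊤
  interpolate-⊤ j y = ∨-zeroˡ (j ∧ y)

  interpolate-⊥-⊤ : ∀ j → interpolate j ⊥ ⊤ ≡ j
  interpolate-⊥-⊤ j = trans (proj₁ ∨-identity (j ∧ ⊤)) (proj₂ ∧-identity j)

  interpolate-∨ : ∀ j x y u v →
    interpolate j (x ∨ u) (y ∨ v) ≡ interpolate j x y ∨ interpolate j u v
  interpolate-∨ j x y u v =
    trans (cong ((x ∨ u) ∨_) (∧-distribˡ-∨ j y v)) (∨-interchange x u (j ∧ y) (j ∧ v))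

  interpolate-∧ : ∀ j {x y u v} → x ≤ y → u ≤ v →
    interpolate j (x ∧ u) (y ∧ v) ≡ interpolate j x y ∧ interpolate j u v
  interpolate-∧ j {x} {y} {u} {v} x≤y u≤v = begin
    x ∧ u ∨ j ∧ (y ∧ v)              ≡⟨ modular j (∧-mono-≤ x≤y u≤v) ⟩
    (x ∧ u ∨ j) ∧ (y ∧ v)            ≡⟨ cong (_∧ (y ∧ v)) (∨-distribʳ-∧ j x u) ⟩
    ((x ∨ j) ∧ (u ∨ j)) ∧ (y ∧ v)    ≡⟨ ∧-interchange (x ∨ j) (u ∨ j) y v ⟩
    ((x ∨ j) ∧ y) ∧ ((u ∨ j) ∧ v)    ≡⟨ cong₂ _∧_ (modular j x≤y) (modular j u≤v) ⟨
    (x ∨ j ∧ y) ∧ (u ∨ j ∧ v)        ∎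

hom-mono-≤ : {a b : Level} {L : BDL a} {M : BDL b} {f : BDL.Carrier L → BDL.Carrier M} →
  IsBDLHom L M f → ∀ {x y} → BDLProperties._≤_ L x y → BDLProperties._≤_ M (f x) (f y)
hom-mono-≤ {f = f} f-hom {x} {y} x≤y = trans (sym (IsBDLHom.pres-∨ f-hom x y)) (cong f x≤y)

module IsIAlgHomFields {i a b : Level} {𝕀 : BDL i} {A : IAlg 𝕀 a} {B : IAlg 𝕀 b}
  {f : IAlg.Carrier A → IAlg.Carrier B} (f-hom : IsIAlgHom A B f) where
  open IsIAlgHom f-hom public
  open IsBDLHom isBDLHom public

module _ {i : Level} {𝕀 : BDL i} where
  private
    module I = BDL 𝕀

  id-isIAlgHom : {a : Level} (A : IAlg 𝕀 a) → IsIAlgHom A A id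
  id-isIAlgHom A = record
    { isBDLHom = record
      { pres-∨ = λ _ _ → refl ; pres-∧ = λ _ _ → refl ; pres-⊥ = refl ; pres-⊤ = refl }
    ; pres-ι = λ _ → refl
    }

  ∘-isIAlgHom : {a b c : Level} {A : IAlg 𝕀 a} {B : IAlg 𝕀 b} {C : IAlg 𝕀 c}
    {g : IAlg.Carrier B → IAlg.Carrier C} {f : IAlg.Carrier A → IAlg.Carrier B} →
    IsIAlgHom B C g → IsIAlgHom A B f → IsIAlgHom A C (g ∘ f)
  ∘-isIAlgHom {g = g} g-hom f-hom = record
    { isBDLHom = record
      { pres-∨ = λ x y → trans (cong g (f.pres-∨ x y)) (g.pres-∨ _ _)
      ; pres-∧ = λ x y → trans (cong g (f.pres-∧ x y)) (g.pres-∧ _ _)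
      ; pres-⊥ = trans (cong g f.pres-⊥) g.pres-⊥
      ; pres-⊤ = trans (cong g f.pres-⊤) g.pres-⊤
      }
    ; pres-ι = λ x → trans (cong g (f.pres-ι x)) (g.pres-ι x)
    }
    where
    module f = IsIAlgHomFields f-hom
    module g = IsIAlgHomFields g-hom

  module _ {a b : Level} {C : IAlg 𝕀 a} {B : IAlg 𝕀 b} where
    private
      module B = IAlg B
      module LB = BDLProperties B.lattice

    interpolate-isIAlgHom : {f g : IAlg.Carrier C → B.Carrier} →
      IsIAlgHom C B f → IsIAlgHom C B g → (∀ y → f y LB.≤ g y) →
      ∀ j → IsIAlgHom C B (λ y → LB.interpolate j (f y) (g y))
    interpolate-isIAlgHom {f} {g} f-hom g-hom f≤g j = record
      { isBDLHom = record
        { pres-∨ = λ y z → trans (cong₂ (LB.interpolate j) (f.pres-∨ y z) (g.pres-∨ y z))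
                                 (LB.interpolate-∨ j _ _ _ _)
        ; pres-∧ = λ y z → trans (cong₂ (LB.interpolate j) (f.pres-∧ y z) (g.pres-∧ y z))
                                 (LB.interpolate-∧ j (f≤g y) (f≤g z))
        ; pres-⊥ = trans (cong₂ (LB.interpolate j) f.pres-⊥ g.pres-⊥)
                         (LB.interpolate-diagonal j B.⊥)
        ; pres-⊤ = trans (cong (λ x → LB.interpolate j x (g _)) f.pres-⊤)
                         (LB.interpolate-⊤ j _)
        }
      ; pres-ι = λ x → trans (cong₂ (LB.interpolate j) (f.pres-ι x) (g.pres-ι x))
                             (LB.interpolate-diagonal j (B.ι x))
      }
      where
      module f = IsIAlgHomFields f-hom
      module g = IsIAlgHomFields g-hom

  module _ {a : Level} {A : IAlg 𝕀 a} (phoa : GenPhoa A) where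
    private
      module A = IAlg A
      module LA = BDLProperties A.lattice

    GenPhoa⇒endpoints-≤ : (α : I.Carrier → A.Carrier) → α I.⊥ LA.≤ α I.⊤
    GenPhoa⇒endpoints-≤ α = begin
      α I.⊥ A.∨ α I.⊤                     ≡⟨ cong (α I.⊥ A.∨_) (proj₁ A.∧-identity (α I.⊤)) ⟨
      α I.⊥ A.∨ A.⊤ A.∧ α I.⊤             ≡⟨ cong (λ t → α I.⊥ A.∨ t A.∧ α I.⊤) ι-⊤ ⟨
      α I.⊥ A.∨ A.ι I.⊤ A.∧ α I.⊤         ≡⟨ phoa α I.⊤ ⟨
      α I.⊤                               ∎
      where
      open ≡-Reasoning
      ι-⊤ : A.ι I.⊤ ≡ A.⊤
      ι-⊤ = IsBDLHom.pres-⊤ A.ι-hom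

    hom-GenPhoa : {b : Level} {B : IAlg 𝕀 b} {h : IAlg.Carrier B → A.Carrier} →
      IsIAlgHom B A h → (α : I.Carrier → IAlg.Carrier B) (x : I.Carrier) →
      h (α x) ≡ h (BDLProperties.interpolate (IAlg.lattice B) (IAlg.ι B x) (α I.⊥) (α I.⊤))
    hom-GenPhoa {B = B} {h = h} h-hom α x = begin
      h (α x)
        ≡⟨ phoa (h ∘ α) x ⟩
      h (α I.⊥) A.∨ A.ι x A.∧ h (α I.⊤)
        ≡⟨ cong (λ t → h (α I.⊥) A.∨ t A.∧ h (α I.⊤)) (h.pres-ι x) ⟨
      h (α I.⊥) A.∨ h (B.ι x) A.∧ h (α I.⊤)
        ≡⟨ cong (h (α I.⊥) A.∨_) (h.pres-∧ _ _) ⟨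
      h (α I.⊥) A.∨ h (B.ι x B.∧ α I.⊤)
        ≡⟨ h.pres-∨ _ _ ⟨
      h (α I.⊥ B.∨ B.ι x B.∧ α I.⊤) ∎
      where
      open ≡-Reasoning
      module B = IAlg B
      module h = IsIAlgHomFields h-hom

module PolynomialAlgebra {i ℓ : Level} {𝕀 : BDL i} {A B : IAlg 𝕀 ℓ}
  {η : IAlg.Carrier A → IAlg.Carrier B} {j : IAlg.Carrier B}
  (P : IsPolynomialAlgebra A B η j) where
  open IsPolynomialAlgebra P
  private
    module I = BDL 𝕀
    module A = IAlg A
    module B = IAlg B
    module LB = BDLProperties B.lattice

  endomorphism-fixing-generators : {k : B.Carrier → B.Carrier} → IsIAlgHom B B k →
    (∀ a → k (η a) ≡ η a) → k j ≡ j → ∀ y → k y ≡ y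
  endomorphism-fixing-generators {k} k-hom k∘η≗η kj≡j y =
    trans (extend-unique B η η-hom j k k-hom k∘η≗η kj≡j y)
          (sym (extend-unique B η η-hom j id (id-isIAlgHom B) (λ _ → refl) refl y))

  evaluate : I.Carrier → B.Carrier → A.Carrier
  evaluate t = extend A id (id-isIAlgHom A) (A.ι t)

  evaluate-isIAlgHom : ∀ t → IsIAlgHom B A (evaluate t)
  evaluate-isIAlgHom t = extend-hom A id (id-isIAlgHom A) (A.ι t)

  evaluate-η : ∀ t a → evaluate t (η a) ≡ a
  evaluate-η t = extend-η A id (id-isIAlgHom A) (A.ι t)

  evaluate-j : ∀ t → evaluate t j ≡ A.ι t
  evaluate-j t = extend-j A id (id-isIAlgHom A) (A.ι t)

  module _ (phoa : GenPhoa A) where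

    normal-form : ∀ y → LB.interpolate j (η (evaluate I.⊥ y)) (η (evaluate I.⊤ y)) ≡ y
    normal-form = endomorphism-fixing-generators normalise-isIAlgHom normalise-η normalise-j
      where
      normalise : B.Carrier → B.Carrier
      normalise y = LB.interpolate j (η (evaluate I.⊥ y)) (η (evaluate I.⊤ y))

      normalise-isIAlgHom : IsIAlgHom B B normalise
      normalise-isIAlgHom = interpolate-isIAlgHom
        (∘-isIAlgHom η-hom (evaluate-isIAlgHom I.⊥))
        (∘-isIAlgHom η-hom (evaluate-isIAlgHom I.⊤))
        (λ y → hom-mono-≤ (IsIAlgHom.isBDLHom η-hom)
                 (GenPhoa⇒endpoints-≤ {A = A} phoa (λ t → evaluate t y)))
        j

      normalise-η : ∀ a → normalise (η a) ≡ η a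
      normalise-η a = trans
        (cong₂ (λ u v → LB.interpolate j (η u) (η v)) (evaluate-η I.⊥ a) (evaluate-η I.⊤ a))
        (LB.interpolate-diagonal j (η a))

      normalise-j : normalise j ≡ j
      normalise-j = begin
        LB.interpolate j (η (evaluate I.⊥ j)) (η (evaluate I.⊤ j))
          ≡⟨ cong₂ (λ u v → LB.interpolate j (η u) (η v)) (evaluate-j I.⊥) (evaluate-j I.⊤) ⟩
        LB.interpolate j (η (A.ι I.⊥)) (η (A.ι I.⊤))
          ≡⟨ cong₂ (LB.interpolate j) (η.pres-ι I.⊥) (η.pres-ι I.⊤) ⟩
        LB.interpolate j (B.ι I.⊥) (B.ι I.⊤)
          ≡⟨ cong₂ (LB.interpolate j) ι.pres-⊥ ι.pres-⊤ ⟩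
        LB.interpolate j B.⊥ B.⊤
          ≡⟨ LB.interpolate-⊥-⊤ j ⟩
        j ∎
        where
        open ≡-Reasoning
        module η = IsIAlgHomFields η-hom
        module ι = IsBDLHom B.ι-hom

    evaluate-⊥-⊤-injective : ∀ {y z} → evaluate I.⊥ y ≡ evaluate I.⊥ z →
      evaluate I.⊤ y ≡ evaluate I.⊤ z → y ≡ z
    evaluate-⊥-⊤-injective {y} {z} y₀≡z₀ y₁≡z₁ = begin
      y
        ≡⟨ normal-form y ⟨
      LB.interpolate j (η (evaluate I.⊥ y)) (η (evaluate I.⊤ y))
        ≡⟨ cong₂ (λ u v → LB.interpolate j (η u) (η v)) y₀≡z₀ y₁≡z₁ ⟩
      LB.interpolate j (η (evaluate I.⊥ z)) (η (evaluate I.⊤ z))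
        ≡⟨ normal-form z ⟩
      z ∎
      where open ≡-Reasoning

theorem7p2 : {i ℓ : Level} {𝕀 : BDL i} (A B : IAlg 𝕀 ℓ)
             (η : IAlg.Carrier A → IAlg.Carrier B) (j : IAlg.Carrier B) →
             IsPolynomialAlgebra A B η j → GenPhoa A → GenPhoa B
theorem7p2 {𝕀 = 𝕀} A B η j P phoa α x =
  evaluate-⊥-⊤-injective phoa
    (hom-GenPhoa phoa (evaluate-isIAlgHom I.⊥) α x)
    (hom-GenPhoa phoa (evaluate-isIAlgHom I.⊤) α x)
  where
  module I = BDL 𝕀
  open PolynomialAlgebra P
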